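{- Let $p$ be a prime and $H$ a graph with a set of distinguished vertices $V^{\mathrm{dist}}\subseteq V(H)$ and distinguished edges $E^{\mathrm{dist}}\subseteq E(H)$. Let $\varrho\in\mathrm{Aut}^{\mathrm{dist}}(H)$ have order $p$ and let $H^\varrho$ be the subgraph of $H$ induced by the fixed points of $\varrho$. If there exists a vertex $v\in V^{\mathrm{dist}}$ with $v\notin V(H^\varrho)$, then for every graph $G$ the number of partially surjective homomorphisms from $G$ to $(H,V^{\mathrm{dist}},E^{\mathrm{dist}})$ is $\equiv0\pmod p$.
   Context: Graphs are finite, undirected, may have loops, no multiple edges. A homomorphism $\phi:G\to H$ (edge-preserving vertex map) is partially surjective with respect to $V^{\mathrm{dist}},E^{\mathrm{dist}}$ if every $v\in V^{\mathrm{dist}}$ equals $\phi(v')$ for some $v'\in V(G)$ and every $(u,v)\in E^{\mathrm{dist}}$ equals $(\phi(u'),\phi(v'))$ for some $(u',v')\in E(G)$. $\mathrm{Aut}^{\mathrm{dist}}(H)$ is the group of automorphisms $\varrho$ of $H$ such that for every vertex $v$, $\varrho(v)\in V^{\mathrm{dist}}$ iff $v\in V^{\mathrm{dist}}$, and for every edge $(u,v)$, $(\varrho(u),\varrho(v))\in E^{\mathrm{dist}}$ iff $(u,v)\in E^{\mathrm{dist}}$. An automorphism has order $p$ if it is not the identity and $\varrho^p=\mathrm{id}$. -}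

module Defs where

open import Data.Nat using (ℕ; zero; suc)
open import Data.Bool using (Bool; true; false)
open import Data.Fin using (Fin; zero; suc)
open import Data.Fin.Properties using (any?; all?)
open import Data.Fin.Permutation using (Permutation′; _⟨$⟩ʳ_)
open import Data.List using (List; []; _∷_; map; concatMap; filter; length)
open import Data.List using () renaming ([_] to singleton)
open import Data.Product using (Σ; ∃; _×_; _,_)
open import Data.Product.Properties using ()
open import Relation.Nullary using (Dec; yes; no; ¬_)
open import Relation.Nullary.Decidable using (_×-dec_; _→-dec_)
open import Relation.Binary.PropositionalEquality using (_≡_; _≢_)
open import Data.Bool.Properties using () renaming (_≟_ to _≟ᵇ_)
open import Data.Fin.Properties using () renaming (_≟_ to _≟ᶠ_)

-- A finite graph on vertex set Fin size: undirected (symmetric adjacency),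
-- loops allowed (adj v v may be true), no multiple edges (adjacency is a relation).
record Graph : Set where
  field
    size : ℕ
    adj  : Fin size → Fin size → Bool
    sym  : ∀ u v → adj u v ≡ adj v u
open Graph public

Edge : (G : Graph) → Fin (size G) → Fin (size G) → Set
Edge G u v = adj G u v ≡ true

record DistGraph : Set where
  field
    graph  : Graph
    Vdist  : Fin (size graph) → Bool
    Edist  : Fin (size graph) → Fin (size graph) → Bool
    Edist-sym : ∀ u v → Edist u v ≡ Edist v u
    Edist⊆E   : ∀ u v → Edist u v ≡ true → Edge graph u v
open DistGraph public

IsHom : (G H : Graph) → (Fin (size G) → Fin (size H)) → Set
IsHom G H φ = ∀ u v → Edge G u v → Edge H (φ u) (φ v)

IsPartSurj : (G : Graph) (H : DistGraph) → (Fin (size G) → Fin (size (graph H))) → Set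
IsPartSurj G H φ =
  (∀ v → Vdist H v ≡ true → ∃ λ v' → φ v' ≡ v) ×
  (∀ u v → Edist H u v ≡ true →
     ∃ λ u' → ∃ λ v' → Edge G u' v' × φ u' ≡ u × φ v' ≡ v)

IsPartSurjHom : (G : Graph) (H : DistGraph) → (Fin (size G) → Fin (size (graph H))) → Set
IsPartSurjHom G H φ = IsHom G (graph H) φ × IsPartSurj G H φ

isPartSurjHom? : (G : Graph) (H : DistGraph) → ∀ φ → Dec (IsPartSurjHom G H φ)
isPartSurjHom? G H φ =
  (all? λ u → all? λ v → (adj G u v ≟ᵇ true) →-dec (adj (graph H) (φ u) (φ v) ≟ᵇ true))
  ×-dec
  ((all? λ v → (Vdist H v ≟ᵇ true) →-dec any? (λ v' → φ v' ≟ᶠ v))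
   ×-dec
   (all? λ u → all? λ v → (Edist H u v ≟ᵇ true) →-dec
      any? (λ u' → any? (λ v' → (adj G u' v' ≟ᵇ true) ×-dec (φ u' ≟ᶠ u) ×-dec (φ v' ≟ᶠ v)))))

cons : ∀ {n m} → Fin m → (Fin n → Fin m) → Fin (suc n) → Fin m
cons i f zero    = i
cons i f (suc k) = f k

allFin′ : (m : ℕ) → List (Fin m)
allFin′ zero    = []
allFin′ (suc m) = zero ∷ map suc (allFin′ m)

allFuns : (n m : ℕ) → List (Fin n → Fin m)
allFuns zero    m = singleton (λ ())
allFuns (suc n) m = concatMap (λ f → map (λ i → cons i f) (allFin′ m)) (allFuns n m)

#PartSurjHom : (G : Graph) (H : DistGraph) → ℕ
#PartSurjHom G H = length (filter (isPartSurjHom? G H) (allFuns (size G) (size (graph H))))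

iter : ∀ {m} → Permutation′ m → ℕ → Fin m → Fin m
iter ρ zero    v = v
iter ρ (suc k) v = ρ ⟨$⟩ʳ (iter ρ k v)

IsAutDist : (H : DistGraph) → Permutation′ (size (graph H)) → Set
IsAutDist H ρ =
  (∀ u v → adj (graph H) (ρ ⟨$⟩ʳ u) (ρ ⟨$⟩ʳ v) ≡ adj (graph H) u v) ×
  (∀ v → Vdist H (ρ ⟨$⟩ʳ v) ≡ Vdist H v) ×
  (∀ u v → Edist H (ρ ⟨$⟩ʳ u) (ρ ⟨$⟩ʳ v) ≡ Edist H u v)

HasOrder : ∀ {m} → Permutation′ m → ℕ → Set
HasOrder ρ p = (∃ λ v → ρ ⟨$⟩ʳ v ≢ v) × (∀ v → iter ρ p v ≡ v)

InFixedSubgraph : ∀ {m} → Permutation′ m → Fin m → Set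
InFixedSubgraph ρ v = ρ ⟨$⟩ʳ v ≡ v

-- Post-composition with ρ permutes the partially surjective homomorphisms G → H, and every
-- such φ meets the ρ-orbit O of the distinguished vertex v, which has exactly p points because
-- p is prime and v is not fixed. Labelling φ by the point of O hit by the first vertex of G
-- that φ maps into O splits these homomorphisms into p classes, and ρ ∘ _ maps the j-th class
-- bijectively onto the (j+1)-th, so all classes have the same size.
module Submission where

open import Defs hiding (sym)
open import Data.Bool using (true; false; if_then_else_)
open import Data.Fin using (Fin; zero; suc; toℕ; _≟_)
open import Data.Fin.Permutation using (Permutation′; _⟨$⟩ʳ_; flip; inverseˡ; inverseʳ)
open import Data.Fin.Properties
  using (any?; 0≢1+n; suc-injective; toℕ-injective; toℕ<n; toℕ-fromℕ<)
open import Data.List using (List; []; _∷_; map; concatMap; filter; length; _++_)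
open import Data.List.Properties using (map-++; map-∘; map-cong)
open import Data.Maybe as Maybe using (Maybe; just; nothing)
open import Data.Maybe.Properties using (just-injective)
  renaming (≡-dec to ≡-dec-Maybe; map-injective to Maybe-map-injective)
open import Data.Nat using (ℕ; zero; suc; _+_; _*_; _∸_; _≤_; _<_; pred; NonZero; >-nonZero)
open import Data.Nat.Coprimality using (Coprime; coprime-Bézout; prime⇒coprime)
open import Data.Nat.Divisibility using (_∣_; m∣m*n)
open import Data.Nat.DivMod using (_%_; _/_; _mod_; m≡m%n+[m/n]*n; m%n<n)
open import Data.Nat.GCD using (module Bézout)
open import Data.Nat.ListAction using () renaming (sum to sumList)
open import Data.Nat.ListAction.Properties using () renaming (sum-++ to sumList-++)
open import Data.Nat.Primality using (Prime; prime⇒nonZero)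
open import Data.Nat.Properties
  using (+-*-semiring; +-identityʳ; <-cmp; m<n⇒0<n∸m; m+[n∸m]≡n; <⇒≤; ≤-<-trans; m∸n≤m; suc-pred)
open import Algebra.Properties.Semiring.Sum +-*-semiring
  using (sum-syntax; sum-cong-≗; sum-replicate-zero; ∑-comm; ∑-permute; *-distribˡ-sum)
open import Data.Product using (∃; _×_; _,_; proj₁; proj₂)
open import Function using (_∘_; _⇔_; mk⇔; Injective)
open import Function.Bundles using (Injection)
open import Function.Properties.Inverse using (Inverse⇒Injection)
import Function.Properties.Equivalence as ⇔
open import Relation.Binary using (DecidableEquality; _Preserves_⟶_; tri<; tri≈; tri>)
open import Relation.Binary.PropositionalEquality
  using (_≡_; _≢_; _≗_; refl; sym; trans; cong; cong₂; subst; subst₂; module ≡-Reasoning)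
open import Relation.Nullary using (Dec; yes; no; does; ¬_; contradiction)
open import Relation.Nullary.Decidable using (does-⇔; dec-true; dec-false)
open import Relation.Unary using (Pred; Decidable)

𝟙[_] : ∀ {a} {A : Set a} → Dec A → ℕ
𝟙[ a? ] = if does a? then 1 else 0

𝟙-⇔ : ∀ {a b} {A : Set a} {B : Set b} → A ⇔ B → (a? : Dec A) (b? : Dec B) → 𝟙[ a? ] ≡ 𝟙[ b? ]
𝟙-⇔ A⇔B a? b? = cong (if_then 1 else 0) (does-⇔ A⇔B a? b?)

𝟙-yes : ∀ {a} {A : Set a} (a? : Dec A) → A → 𝟙[ a? ] ≡ 1
𝟙-yes a? a = cong (if_then 1 else 0) (dec-true a? a)

𝟙-no : ∀ {a} {A : Set a} (a? : Dec A) → ¬ A → 𝟙[ a? ] ≡ 0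
𝟙-no a? ¬a = cong (if_then 1 else 0) (dec-false a? ¬a)

𝟙-*-absorb : ∀ {a} {A : Set a} (a? : Dec A) {n : ℕ} → (A → n ≡ 1) → 𝟙[ a? ] * n ≡ 𝟙[ a? ]
𝟙-*-absorb (yes a) n≡1 = trans (+-identityʳ _) (n≡1 a)
𝟙-*-absorb (no _)  _   = refl

module _ {a} {A : Set a} where

  length-filter : ∀ {p} {P : Pred A p} (P? : Decidable P) (xs : List A) →
    length (filter P? xs) ≡ sumList (map (λ x → 𝟙[ P? x ]) xs)
  length-filter P? []       = refl
  length-filter P? (x ∷ xs) with does (P? x)
  ... | true  = cong suc (length-filter P? xs)
  ... | false = length-filter P? xs

  sumList-concatMap : ∀ {b} {B : Set b} (w : B → ℕ) (g : A → List B) xs →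
    sumList (map w (concatMap g xs)) ≡ sumList (map (λ x → sumList (map w (g x))) xs)
  sumList-concatMap w g []       = refl
  sumList-concatMap w g (x ∷ xs) = begin
    sumList (map w (g x ++ concatMap g xs))
      ≡⟨ cong sumList (map-++ w (g x) (concatMap g xs)) ⟩
    sumList (map w (g x) ++ map w (concatMap g xs))
      ≡⟨ sumList-++ (map w (g x)) _ ⟩
    sumList (map w (g x)) + sumList (map w (concatMap g xs))
      ≡⟨ cong (sumList (map w (g x)) +_) (sumList-concatMap w g xs) ⟩
    sumList (map w (g x)) + sumList (map (λ x → sumList (map w (g x))) xs) ∎
    where open ≡-Reasoning

  ∑-𝟙-injective : (_≟ᴬ_ : DecidableEquality A) {k : ℕ} (g : Fin k → A) →
    Injective _≡_ _≡_ g → ∀ i → ∑[ j < k ] 𝟙[ g i ≟ᴬ g j ] ≡ 1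
  ∑-𝟙-injective _≟ᴬ_ {suc k} g g-inj zero = cong₂ _+_ (𝟙-yes (g zero ≟ᴬ g zero) refl) (begin
    ∑[ j < k ] 𝟙[ g zero ≟ᴬ g (suc j) ]
      ≡⟨ sum-cong-≗ (λ j → 𝟙-no (g zero ≟ᴬ g (suc j)) (0≢1+n ∘ g-inj)) ⟩
    ∑[ j < k ] 0
      ≡⟨ sum-replicate-zero k ⟩
    0 ∎)
    where open ≡-Reasoning
  ∑-𝟙-injective _≟ᴬ_ {suc k} g g-inj (suc i) = cong₂ _+_
    (𝟙-no (g (suc i) ≟ᴬ g zero) (0≢1+n ∘ sym ∘ g-inj))
    (∑-𝟙-injective _≟ᴬ_ (g ∘ suc) (suc-injective ∘ g-inj) i)

∑-const : ∀ k c → ∑[ i < k ] c ≡ k * c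
∑-const zero    c = refl
∑-const (suc k) c = cong (c +_) (∑-const k c)

sumList-allFin′ : ∀ {b} {B : Set b} m (u : Fin m → B) (w : B → ℕ) →
  sumList (map w (map u (allFin′ m))) ≡ ∑[ i < m ] w (u i)
sumList-allFin′ zero    u w = refl
sumList-allFin′ (suc m) u w = cong (w (u zero) +_)
  (trans (cong (sumList ∘ map w) (sym (map-∘ (allFin′ m)))) (sumList-allFin′ m (u ∘ suc) w))

cons-cong : ∀ {n m} (i : Fin m) {f g : Fin n → Fin m} → f ≗ g → cons i f ≗ cons i g
cons-cong i f≗g zero    = refl
cons-cong i f≗g (suc x) = f≗g x

-- Unlike a sum over the list allFuns n m, this respects pointwise equality of maps, so it
-- can be reindexed by post-composition with a permutation.
sumFun : ∀ {m} n → ((Fin n → Fin m) → ℕ) → ℕ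
sumFun     zero    w = w (λ ())
sumFun {m} (suc n) w = sumFun n (λ f → ∑[ i < m ] w (cons i f))

sumList-allFuns : ∀ n m (w : (Fin n → Fin m) → ℕ) → sumList (map w (allFuns n m)) ≡ sumFun n w
sumList-allFuns zero    m w = +-identityʳ _
sumList-allFuns (suc n) m w = begin
  sumList (map w (concatMap (λ f → map (λ i → cons i f) (allFin′ m)) (allFuns n m)))
    ≡⟨ sumList-concatMap w _ (allFuns n m) ⟩
  sumList (map (λ f → sumList (map w (map (λ i → cons i f) (allFin′ m)))) (allFuns n m))
    ≡⟨ cong sumList (map-cong (λ f → sumList-allFin′ m (λ i → cons i f) w) (allFuns n m)) ⟩
  sumList (map (λ f → ∑[ i < m ] w (cons i f)) (allFuns n m))
    ≡⟨ sumList-allFuns n m _ ⟩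
  sumFun (suc n) w ∎
  where open ≡-Reasoning

module _ {m : ℕ} where

  sumFun-cong : ∀ n {w w′ : (Fin n → Fin m) → ℕ} → w ≗ w′ → sumFun n w ≡ sumFun n w′
  sumFun-cong zero    w≗w′ = w≗w′ _
  sumFun-cong (suc n) w≗w′ = sumFun-cong n (λ f → sum-cong-≗ (λ i → w≗w′ (cons i f)))

  sumFun-∑-comm : ∀ n {k} (w : Fin k → (Fin n → Fin m) → ℕ) →
    sumFun n (λ f → ∑[ j < k ] w j f) ≡ ∑[ j < k ] sumFun n (w j)
  sumFun-∑-comm zero    w = refl
  sumFun-∑-comm (suc n) w = trans (sumFun-cong n (λ f → ∑-comm (λ i j → w j (cons i f))))
                                  (sumFun-∑-comm n (λ j f → ∑[ i < m ] w j (cons i f)))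

  sumFun-∘-perm : ∀ n (σ : Permutation′ m) {w : (Fin n → Fin m) → ℕ} →
    w Preserves _≗_ ⟶ _≡_ → sumFun n (λ f → w ((σ ⟨$⟩ʳ_) ∘ f)) ≡ sumFun n w
  sumFun-∘-perm zero    σ w-cong = w-cong (λ ())
  sumFun-∘-perm (suc n) σ {w} w-cong = begin
    sumFun n (λ f → ∑[ i < m ] w ((σ ⟨$⟩ʳ_) ∘ cons i f))
      ≡⟨ sumFun-cong n (λ f → sum-cong-≗ (λ i → w-cong (σ∘cons i f))) ⟩
    sumFun n (λ f → ∑[ i < m ] w (cons (σ ⟨$⟩ʳ i) ((σ ⟨$⟩ʳ_) ∘ f)))
      ≡⟨ sumFun-cong n (λ f → ∑-permute (λ i → w (cons i ((σ ⟨$⟩ʳ_) ∘ f))) σ) ⟨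
    sumFun n (λ f → w′ ((σ ⟨$⟩ʳ_) ∘ f))
      ≡⟨ sumFun-∘-perm n σ w′-cong ⟩
    sumFun n w′ ∎
    where
    open ≡-Reasoning
    σ∘cons : ∀ i f → (σ ⟨$⟩ʳ_) ∘ cons i f ≗ cons (σ ⟨$⟩ʳ i) ((σ ⟨$⟩ʳ_) ∘ f)
    σ∘cons i f zero    = refl
    σ∘cons i f (suc x) = refl
    w′ : (Fin n → Fin m) → ℕ
    w′ g = ∑[ i < m ] w (cons i g)
    w′-cong : w′ Preserves _≗_ ⟶ _≡_
    w′-cong {f} {g} f≗g = sum-cong-≗ {m} (λ i → w-cong {cons i f} {cons i g} (cons-cong i f≗g))

  sumFun-∑-shift : ∀ n (σ : Permutation′ m) k (w : ℕ → (Fin n → Fin m) → ℕ) →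
    (∀ j → w j Preserves _≗_ ⟶ _≡_) → (∀ j f → w (suc j) ((σ ⟨$⟩ʳ_) ∘ f) ≡ w j f) →
    sumFun n (λ f → ∑[ j < k ] w (toℕ j) f) ≡ k * sumFun n (w 0)
  sumFun-∑-shift n σ k w w-cong w-shift = begin
    sumFun n (λ f → ∑[ j < k ] w (toℕ j) f) ≡⟨ sumFun-∑-comm n {k} (w ∘ toℕ) ⟩
    ∑[ j < k ] sumFun n (w (toℕ j))         ≡⟨ sum-cong-≗ {k} (sumFun-w≡sumFun-w₀ ∘ toℕ) ⟩
    ∑[ j < k ] sumFun n (w 0)               ≡⟨ ∑-const k _ ⟩
    k * sumFun n (w 0)                      ∎
    where
    open ≡-Reasoning
    sumFun-w≡sumFun-w₀ : ∀ j → sumFun n (w j) ≡ sumFun n (w 0)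
    sumFun-w≡sumFun-w₀ zero    = refl
    sumFun-w≡sumFun-w₀ (suc j) = begin
      sumFun n (w (suc j))                       ≡⟨ sumFun-∘-perm n σ (w-cong (suc j)) ⟨
      sumFun n (λ f → w (suc j) ((σ ⟨$⟩ʳ_) ∘ f)) ≡⟨ sumFun-cong n (w-shift j) ⟩
      sumFun n (w j)                             ≡⟨ sumFun-w≡sumFun-w₀ j ⟩
      sumFun n (w 0)                             ∎

module _ {a p} {A : Set a} {P : Pred A p} (P? : Decidable P) where

  first : ∀ {k} → (Fin k → A) → Maybe A
  first {zero}  φ = nothing
  first {suc k} φ = if does (P? (φ zero)) then just (φ zero) else first (φ ∘ suc)

  first-cong : ∀ {k} {φ ψ : Fin k → A} → φ ≗ ψ → first φ ≡ first ψ
  first-cong {zero}          φ≗ψ = refl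
  first-cong {suc k} {φ} {ψ} φ≗ψ rewrite φ≗ψ zero =
    cong (if does (P? (ψ zero)) then just (ψ zero) else_) (first-cong (φ≗ψ ∘ suc))

  first-satisfies : ∀ {k} (φ : Fin k → A) x → P (φ x) → ∃ λ y → first φ ≡ just y × P y
  first-satisfies φ zero Pφ₀ with P? (φ zero)
  ... | yes Pφ₀′ = φ zero , refl , Pφ₀′
  ... | no ¬Pφ₀  = contradiction Pφ₀ ¬Pφ₀
  first-satisfies φ (suc x) Pφx with P? (φ zero)
  ... | yes Pφ₀ = φ zero , refl , Pφ₀
  ... | no _    = first-satisfies (φ ∘ suc) x Pφx

  first-∘ : (σ : A → A) → (∀ y → P (σ y) ⇔ P y) →
    ∀ {k} (φ : Fin k → A) → first (σ ∘ φ) ≡ Maybe.map σ (first φ)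
  first-∘ σ Pσ⇔P {zero}  φ = refl
  first-∘ σ Pσ⇔P {suc k} φ
    rewrite does-⇔ (Pσ⇔P (φ zero)) (P? (σ (φ zero))) (P? (φ zero))
    with does (P? (φ zero))
  ... | true  = refl
  ... | false = first-∘ σ Pσ⇔P (φ ∘ suc)

⟨$⟩ʳ-injective : ∀ {m} (ρ : Permutation′ m) → Injective _≡_ _≡_ (ρ ⟨$⟩ʳ_)
⟨$⟩ʳ-injective ρ = Injection.injective (Inverse⇒Injection ρ)

module _ {m} (ρ : Permutation′ m) where

  iter-+ : ∀ a b v → iter ρ (a + b) v ≡ iter ρ a (iter ρ b v)
  iter-+ zero    b v = refl
  iter-+ (suc a) b v = cong (ρ ⟨$⟩ʳ_) (iter-+ a b v)

  iter-injective : ∀ a → Injective _≡_ _≡_ (iter ρ a)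
  iter-injective zero    eq = eq
  iter-injective (suc a) eq = iter-injective a (⟨$⟩ʳ-injective ρ eq)

  iter-*-fixed : ∀ {t v} → iter ρ t v ≡ v → ∀ c → iter ρ (c * t) v ≡ v
  iter-*-fixed         ρᵗv≡v zero    = refl
  iter-*-fixed {t} {v} ρᵗv≡v (suc c) = begin
    iter ρ (t + c * t) v        ≡⟨ iter-+ t (c * t) v ⟩
    iter ρ t (iter ρ (c * t) v) ≡⟨ cong (iter ρ t) (iter-*-fixed ρᵗv≡v c) ⟩
    iter ρ t v                  ≡⟨ ρᵗv≡v ⟩
    v                           ∎
    where open ≡-Reasoning

  iter-% : ∀ {p v} .{{_ : NonZero p}} → iter ρ p v ≡ v → ∀ t → iter ρ t v ≡ iter ρ (t % p) v
  iter-% {p} {v} ρᵖv≡v t = begin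
    iter ρ t v                              ≡⟨ cong (λ s → iter ρ s v) (m≡m%n+[m/n]*n t p) ⟩
    iter ρ (t % p + (t / p) * p) v          ≡⟨ iter-+ (t % p) ((t / p) * p) v ⟩
    iter ρ (t % p) (iter ρ ((t / p) * p) v) ≡⟨ cong (iter ρ (t % p)) (iter-*-fixed ρᵖv≡v (t / p)) ⟩
    iter ρ (t % p) v                        ∎
    where open ≡-Reasoning

  iter-period-∸ : ∀ {j k v} → j ≤ k → iter ρ j v ≡ iter ρ k v → iter ρ (k ∸ j) v ≡ v
  iter-period-∸ {j} {k} {v} j≤k ρʲv≡ρᵏv = iter-injective j (begin
    iter ρ j (iter ρ (k ∸ j) v) ≡⟨ iter-+ j (k ∸ j) v ⟨
    iter ρ (j + (k ∸ j)) v      ≡⟨ cong (λ s → iter ρ s v) (m+[n∸m]≡n j≤k) ⟩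
    iter ρ k v                  ≡⟨ ρʲv≡ρᵏv ⟨
    iter ρ j v                  ∎)
    where open ≡-Reasoning

  fixed-by-Bézout : ∀ a b {v} x y → 1 + y * b ≡ x * a →
    iter ρ a v ≡ v → iter ρ b v ≡ v → ρ ⟨$⟩ʳ v ≡ v
  fixed-by-Bézout a b {v} x y eq ρᵃv≡v ρᵇv≡v = begin
    ρ ⟨$⟩ʳ v             ≡⟨ cong (ρ ⟨$⟩ʳ_) (iter-*-fixed ρᵇv≡v y) ⟨
    iter ρ (1 + y * b) v ≡⟨ cong (λ s → iter ρ s v) eq ⟩
    iter ρ (x * a) v     ≡⟨ iter-*-fixed ρᵃv≡v x ⟩
    v                    ∎
    where open ≡-Reasoning

  fixed-by-coprime-periods : ∀ {a b v} → Coprime a b →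
    iter ρ a v ≡ v → iter ρ b v ≡ v → ρ ⟨$⟩ʳ v ≡ v
  fixed-by-coprime-periods {a} {b} a⊥b ρᵃv≡v ρᵇv≡v with coprime-Bézout a⊥b
  ... | Bézout.+- x y eq = fixed-by-Bézout a b x y eq ρᵃv≡v ρᵇv≡v
  ... | Bézout.-+ x y eq = fixed-by-Bézout b a y x eq ρᵇv≡v ρᵃv≡v

  module _ {p v} (p-prime : Prime p) (ρᵖv≡v : iter ρ p v ≡ v) (ρv≢v : ρ ⟨$⟩ʳ v ≢ v) where

    iter-distinct-below-prime : ∀ {j k} → j < k → k < p → iter ρ j v ≢ iter ρ k v
    iter-distinct-below-prime {j} {k} j<k k<p ρʲv≡ρᵏv = ρv≢v (fixed-by-coprime-periods
      (prime⇒coprime p-prime {{>-nonZero (m<n⇒0<n∸m j<k)}} (≤-<-trans (m∸n≤m k j) k<p))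
      ρᵖv≡v (iter-period-∸ (<⇒≤ j<k) ρʲv≡ρᵏv))

    iter-injective-below-prime : ∀ {j k} → j < p → k < p → iter ρ j v ≡ iter ρ k v → j ≡ k
    iter-injective-below-prime {j} {k} j<p k<p ρʲv≡ρᵏv with <-cmp j k
    ... | tri< j<k _ _ = contradiction ρʲv≡ρᵏv (iter-distinct-below-prime j<k k<p)
    ... | tri≈ _ j≡k _ = j≡k
    ... | tri> _ _ k<j = contradiction (sym ρʲv≡ρᵏv) (iter-distinct-below-prime k<j j<p)

module _ {m} (σ : Permutation′ m) {p} .{{_ : NonZero p}}
         (v₀ : Fin m) (σᵖv₀≡v₀ : iter σ p v₀ ≡ v₀)
         (orbit-injective : Injective _≡_ _≡_ (λ (j : Fin p) → iter σ (toℕ j) v₀)) where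

  orbit : Fin p → Fin m
  orbit j = iter σ (toℕ j) v₀

  InOrbit : Fin m → Set
  InOrbit y = ∃ λ j → orbit j ≡ y

  inOrbit? : Decidable InOrbit
  inOrbit? y = any? (λ j → orbit j ≟ y)

  iter-inOrbit : ∀ t → InOrbit (iter σ t v₀)
  iter-inOrbit t =
    t mod p , trans (cong (λ s → iter σ s v₀) (toℕ-fromℕ< (m%n<n t p))) (sym (iter-% σ σᵖv₀≡v₀ t))

  InOrbit-preimage : ∀ t {y} → iter σ t v₀ ≡ σ ⟨$⟩ʳ y → InOrbit y
  InOrbit-preimage (suc t) eq = subst InOrbit (⟨$⟩ʳ-injective σ eq) (iter-inOrbit t)
  InOrbit-preimage zero    eq =
    subst InOrbit (⟨$⟩ʳ-injective σ (trans σ[σᵖ⁻¹v₀]≡v₀ eq)) (iter-inOrbit (pred p))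
    where
    σ[σᵖ⁻¹v₀]≡v₀ : iter σ (suc (pred p)) v₀ ≡ v₀
    σ[σᵖ⁻¹v₀]≡v₀ = trans (cong (λ s → iter σ s v₀) (suc-pred p)) σᵖv₀≡v₀

  InOrbit-σ : ∀ y → InOrbit (σ ⟨$⟩ʳ y) ⇔ InOrbit y
  InOrbit-σ y = mk⇔ (λ (j , eq) → InOrbit-preimage (toℕ j) eq)
                    (λ (j , eq) → subst InOrbit (cong (σ ⟨$⟩ʳ_) eq) (iter-inOrbit (suc (toℕ j))))

  hitOrbit : ∀ {n} → (Fin n → Fin m) → Maybe (Fin m)
  hitOrbit = first inOrbit?

  module _ {n} {P : (Fin n → Fin m) → Set} (P? : Decidable P)
           (P-cong : ∀ {f g} → f ≗ g → P f → P g)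
           (P-σ : ∀ f → P f ⇔ P ((σ ⟨$⟩ʳ_) ∘ f))
           (P-hits : ∀ f → P f → ∃ λ x → f x ≡ v₀) where

    private
      _≟ᴹ_ : DecidableEquality (Maybe (Fin m))
      _≟ᴹ_ = ≡-dec-Maybe _≟_

    weight : ℕ → (Fin n → Fin m) → ℕ
    weight j f = 𝟙[ P? f ] * 𝟙[ hitOrbit f ≟ᴹ just (iter σ j v₀) ]

    weight-cong : ∀ j → weight j Preserves _≗_ ⟶ _≡_
    weight-cong j {f} {g} f≗g = cong₂ _*_
      (𝟙-⇔ (mk⇔ (P-cong f≗g) (P-cong (sym ∘ f≗g))) (P? f) (P? g))
      (cong (λ h → 𝟙[ h ≟ᴹ just (iter σ j v₀) ]) (first-cong inOrbit? f≗g))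

    weight-shift : ∀ j f → weight (suc j) ((σ ⟨$⟩ʳ_) ∘ f) ≡ weight j f
    weight-shift j f = cong₂ _*_ (𝟙-⇔ (⇔.sym (P-σ f)) (P? ((σ ⟨$⟩ʳ_) ∘ f)) (P? f)) (begin
      𝟙[ hitOrbit ((σ ⟨$⟩ʳ_) ∘ f) ≟ᴹ just (σ ⟨$⟩ʳ y) ]
        ≡⟨ cong (λ h → 𝟙[ h ≟ᴹ just (σ ⟨$⟩ʳ y) ]) (first-∘ inOrbit? (σ ⟨$⟩ʳ_) InOrbit-σ f) ⟩
      𝟙[ Maybe.map (σ ⟨$⟩ʳ_) (hitOrbit f) ≟ᴹ just (σ ⟨$⟩ʳ y) ]
        ≡⟨ 𝟙-⇔ (mk⇔ (Maybe-map-injective (⟨$⟩ʳ-injective σ)) (cong (Maybe.map (σ ⟨$⟩ʳ_))))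
               (Maybe.map (σ ⟨$⟩ʳ_) (hitOrbit f) ≟ᴹ just (σ ⟨$⟩ʳ y)) (hitOrbit f ≟ᴹ just y) ⟩
      𝟙[ hitOrbit f ≟ᴹ just y ] ∎)
      where
      open ≡-Reasoning
      y : Fin m
      y = iter σ j v₀

    ∑-weight : ∀ f → ∑[ j < p ] weight (toℕ j) f ≡ 𝟙[ P? f ]
    ∑-weight f = begin
      ∑[ j < p ] weight (toℕ j) f         ≡⟨ *-distribˡ-sum 𝟙[ P? f ] hits ⟨
      𝟙[ P? f ] * ∑[ j < p ] hits j       ≡⟨ 𝟙-*-absorb (P? f) ∑-hits≡1 ⟩
      𝟙[ P? f ]                           ∎
      where
      open ≡-Reasoning
      hits : Fin p → ℕ
      hits j = 𝟙[ hitOrbit f ≟ᴹ just (orbit j) ]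
      ∑-hits≡1 : P f → ∑[ j < p ] hits j ≡ 1
      ∑-hits≡1 Pf with P-hits f Pf
      ... | x , fx≡v₀ with first-satisfies inOrbit? f x (subst InOrbit (sym fx≡v₀) (iter-inOrbit 0))
      ... | y , hit≡y , i , orbit-i≡y rewrite hit≡y | sym orbit-i≡y =
        ∑-𝟙-injective _≟ᴹ_ (just ∘ orbit) (orbit-injective ∘ just-injective) i

    orbit-size∣count : p ∣ length (filter P? (allFuns n m))
    orbit-size∣count = subst (p ∣_) (sym (begin
      length (filter P? (allFuns n m))
        ≡⟨ length-filter P? (allFuns n m) ⟩
      sumList (map (λ f → 𝟙[ P? f ]) (allFuns n m))
        ≡⟨ sumList-allFuns n m _ ⟩
      sumFun n (λ f → 𝟙[ P? f ])
        ≡⟨ sumFun-cong n ∑-weight ⟨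
      sumFun n (λ f → ∑[ j < p ] weight (toℕ j) f)
        ≡⟨ sumFun-∑-shift n σ p weight weight-cong weight-shift ⟩
      p * sumFun n (weight 0) ∎)) (m∣m*n _)
      where open ≡-Reasoning

IsAutDist-flip : ∀ {H : DistGraph} {ρ} → IsAutDist H ρ → IsAutDist H (flip ρ)
IsAutDist-flip {H} {ρ} (adj-ρ , Vdist-ρ , Edist-ρ) =
  (λ u v → trans (sym (adj-ρ (flip ρ ⟨$⟩ʳ u) (flip ρ ⟨$⟩ʳ v)))
                 (cong₂ (adj (graph H)) (inverseʳ ρ) (inverseʳ ρ))) ,
  (λ v → trans (sym (Vdist-ρ (flip ρ ⟨$⟩ʳ v))) (cong (Vdist H) (inverseʳ ρ))) ,
  (λ u v → trans (sym (Edist-ρ (flip ρ ⟨$⟩ʳ u) (flip ρ ⟨$⟩ʳ v)))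
                 (cong₂ (Edist H) (inverseʳ ρ) (inverseʳ ρ)))

module _ {G : Graph} {H : DistGraph} where

  IsPartSurjHom-cong : ∀ {φ ψ} → φ ≗ ψ → IsPartSurjHom G H φ → IsPartSurjHom G H ψ
  IsPartSurjHom-cong φ≗ψ (hom , onto-V , onto-E) =
    (λ u v uv → subst₂ (Edge (graph H)) (φ≗ψ u) (φ≗ψ v) (hom u v uv)) ,
    (λ v v∈V → let (x , φx≡v) = onto-V v v∈V in x , trans (sym (φ≗ψ x)) φx≡v) ,
    (λ u v uv∈E → let (u′ , v′ , u′v′ , φu′≡u , φv′≡v) = onto-E u v uv∈E in
       u′ , v′ , u′v′ , trans (sym (φ≗ψ u′)) φu′≡u , trans (sym (φ≗ψ v′)) φv′≡v)

  IsPartSurjHom-∘ : ∀ {ρ φ} → IsAutDist H ρ →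
    IsPartSurjHom G H φ → IsPartSurjHom G H ((ρ ⟨$⟩ʳ_) ∘ φ)
  IsPartSurjHom-∘ {ρ} {φ} aut (hom , onto-V , onto-E) =
    (λ u v uv → trans (proj₁ aut (φ u) (φ v)) (hom u v uv)) ,
    (λ v v∈V → let (x , φx≡ρ⁻¹v) = onto-V (ρ⁻¹ v) (trans (Vdist-ρ⁻¹ v) v∈V) in
       x , ρ-cancel φx≡ρ⁻¹v) ,
    (λ u v uv∈E →
       let (u′ , v′ , u′v′ , φu′≡ρ⁻¹u , φv′≡ρ⁻¹v) =
             onto-E (ρ⁻¹ u) (ρ⁻¹ v) (trans (Edist-ρ⁻¹ u v) uv∈E)
       in u′ , v′ , u′v′ , ρ-cancel φu′≡ρ⁻¹u , ρ-cancel φv′≡ρ⁻¹v)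
    where
    ρ⁻¹ : Fin (size (graph H)) → Fin (size (graph H))
    ρ⁻¹ = flip ρ ⟨$⟩ʳ_
    ρ-cancel : ∀ {x y} → x ≡ ρ⁻¹ y → ρ ⟨$⟩ʳ x ≡ y
    ρ-cancel x≡ρ⁻¹y = trans (cong (ρ ⟨$⟩ʳ_) x≡ρ⁻¹y) (inverseʳ ρ)
    Vdist-ρ⁻¹ : ∀ v → Vdist H (ρ⁻¹ v) ≡ Vdist H v
    Vdist-ρ⁻¹ = proj₁ (proj₂ (IsAutDist-flip {H} {ρ} aut))
    Edist-ρ⁻¹ : ∀ u v → Edist H (ρ⁻¹ u) (ρ⁻¹ v) ≡ Edist H u v
    Edist-ρ⁻¹ = proj₂ (proj₂ (IsAutDist-flip {H} {ρ} aut))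

  IsPartSurjHom-∘-⇔ : ∀ {ρ} → IsAutDist H ρ →
    ∀ φ → IsPartSurjHom G H φ ⇔ IsPartSurjHom G H ((ρ ⟨$⟩ʳ_) ∘ φ)
  IsPartSurjHom-∘-⇔ {ρ} aut φ = mk⇔ (IsPartSurjHom-∘ {ρ} aut)
    (IsPartSurjHom-cong (λ x → inverseˡ ρ) ∘ IsPartSurjHom-∘ {flip ρ} (IsAutDist-flip {H} {ρ} aut))

lemma7p1 : (p : ℕ) → Prime p → (H : DistGraph) → (ρ : Permutation′ (size (graph H))) →
    IsAutDist H ρ → HasOrder ρ p →
    (∃ λ v → Vdist H v ≡ true × ¬ InFixedSubgraph ρ v) →
    (G : Graph) → p ∣ #PartSurjHom G H
lemma7p1 p p-prime H ρ aut (_ , ρᵖ≡id) (v₀ , v₀∈Vdist , ρv₀≢v₀) G =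
  orbit-size∣count ρ v₀ (ρᵖ≡id v₀) orbit-injective (isPartSurjHom? G H)
    (IsPartSurjHom-cong {G} {H}) (IsPartSurjHom-∘-⇔ {G} {H} {ρ} aut) hits-v₀
  where
  instance
    p-nonZero : NonZero p
    p-nonZero = prime⇒nonZero p-prime
  orbit-injective : Injective _≡_ _≡_ (λ (j : Fin p) → iter ρ (toℕ j) v₀)
  orbit-injective {j} {k} = toℕ-injective ∘
    iter-injective-below-prime ρ p-prime (ρᵖ≡id v₀) ρv₀≢v₀ (toℕ<n j) (toℕ<n k)
  hits-v₀ : ∀ φ → IsPartSurjHom G H φ → ∃ λ x → φ x ≡ v₀
  hits-v₀ φ (_ , onto-V , _) = onto-V v₀ v₀∈Vdist
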